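{- Let $n,m\ge 1$ be integers and let $a\in\{0,1\}^{m+1}$ be any keyword. Then the number of equivalence classes of $\{0,1\}^n$ under the equivalence relation $\sim_a$ is equal to $F_0^{(m)}+F_1^{(m)}+\cdots+F_n^{(m)}$.
   Context: For a positive integer $m$, the $m$-step Fibonacci numbers $(F_n^{(m)})_{n\ge 0}$ are defined by $F_0^{(m)}=1$, $F_n^{(m)}=2^{n-1}$ for $n\in\{1,\dots,m-1\}$, and $F_n^{(m)}=F_{n-1}^{(m)}+\cdots+F_{n-m}^{(m)}$ for $n\ge m$. A binary word of length $n$ is an element $u=(u_1,\dots,u_n)\in\{0,1\}^n$; its negation $\neg u$ is obtained by replacing every $0$ by $1$ and every $1$ by $0$. For $u\in\{0,1\}^n$ and $1\le i\le j\le n$ write $u_{[i,j]}=(u_i,\dots,u_j)$. Fix a keyword $a\in\{0,1\}^{m+1}$. For $i\in\{1,\dots,n\}$, the simple map $\varphi_i^{(a)}:\{0,1\}^n\to\{0,1\}^n$ is defined as follows: if $i+m\le n$ and $u_{[i,i+m]}\in\{a,\neg a\}$, then $\varphi_i^{(a)}(u)$ is obtained from $u$ by negating exactly the letters in positions $i,\dots,i+m$; otherwise $\varphi_i^{(a)}(u)=u$. Write $u\sim_a v$ if there is a finite (possibly empty) sequence of indices $i_1,\dots,i_r$ with $(\varphi_{i_r}^{(a)}\circ\cdots\circ\varphi_{i_1}^{(a)})(u)=v$; this is an equivalence relation on $\{0,1\}^n$ (informally: an occurrence of $a$ as a contiguous subword may be replaced by $\neg a$ and vice versa, repeatedly). 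-}

module Defs where

open import Data.Bool using (Bool; true; false; not; if_then_else_; _∨_; _∧_)
open import Data.Nat using (ℕ; zero; suc; _+_; _^_; _<ᵇ_; _≤ᵇ_; _∸_)
open import Data.Fin using (Fin; toℕ)
open import Data.List using (List; []; _∷_; take; drop; foldl; map)
open import Data.Nat.ListAction using (sum)
open import Data.List.Properties using (≡-dec)
open import Data.Vec using (Vec; toList; tabulate; lookup)
open import Data.Product using (Σ; _×_; ∃)
open import Relation.Binary.PropositionalEquality using (_≡_; _≢_)
open import Relation.Nullary.Decidable using (⌊_⌋)
import Data.Bool.Properties as BP

Word : ℕ → Set
Word n = Vec Bool n

negL : List Bool → List Bool
negL = map not

eqL : List Bool → List Bool → Bool
eqL u v = ⌊ ≡-dec BP._≟_ u v ⌋

-- The simple map φ_i^{(a)} for i = toℕ j + 1, keyword a of length m+1.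
-- The window u_[i,i+m] is  take (m+1) (drop (i-1) u); it equals a or ¬a
-- only if it has full length m+1, i.e. only if i+m ≤ n.
φ : ∀ {m n} → Vec Bool (suc m) → Fin n → Word n → Word n
φ {m} {n} a j u =
  if ((n' ≤ᵇ n) ∧ (eqL w (toList a) ∨ eqL w (negL (toList a))))
  then tabulate (λ k → if (toℕ j ≤ᵇ toℕ k) ∧ (toℕ k <ᵇ n')
                       then not (lookup u k) else lookup u k)
  else u
  where
  n' = toℕ j + suc m          -- = i + m, positions i..i+m are j..j+m (0-based)
  w  = take (suc m) (drop (toℕ j) (toList u))

applySeq : ∀ {m n} → Vec Bool (suc m) → List (Fin n) → Word n → Word n
applySeq a is u = foldl (λ w i → φ a i w) u is

_∼⟨_⟩_ : ∀ {m n} → Word n → Vec Bool (suc m) → Word n → Set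
u ∼⟨ a ⟩ v = ∃ λ is → applySeq a is u ≡ v

-- The list [F_n, F_{n-1}, ..., F_0] of m-step Fibonacci numbers.
fibList : ℕ → ℕ → List ℕ
fibList m zero = 1 ∷ []
fibList m (suc n) = next ∷ prev
  where
  prev = fibList m n
  next = if suc n <ᵇ m then 2 ^ n else sum (take m prev)

fibSum : ℕ → ℕ → ℕ
fibSum m n = sum (fibList m n)

NumClasses : ∀ {m} → (n : ℕ) → Vec Bool (suc m) → ℕ → Set
NumClasses n a N =
  Σ (Fin N → Word n) λ r →
    (∀ p q → p ≢ q → ¬' (r p ∼⟨ a ⟩ r q)) ×
    (∀ (u : Word n) → ∃ λ p → u ∼⟨ a ⟩ r p)
  where
  open import Data.Empty using (⊥)
  ¬' : Set → Set
  ¬' A = A → ⊥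

{-# OPTIONS --safe #-}
-- Writing suffix c for the tail of whichever of a, ¬a begins with the
-- letter c, a move replaces a factor c·suffix c by ¬c·suffix ¬c. By strong induction on the length,
-- following a derivation and recording whether the first letter has been flipped, one shows that
-- c·y ∼ c·y′ iff y ∼ y′, and that c·y ∼ ¬c·y′ iff y ∼ suffix c·z and y′ ∼ suffix ¬c·z for some z.
-- Consequently ∼ is decidable, and from transversals R of the words of length N and Q of those of
-- length N − m one obtains the transversal ¬c·R ∪ c·R′ of the words of length N + 1, where R′ keeps
-- the members of R not equivalent to any suffix c·q with q ∈ Q. Hence the class numbers satisfy
-- C(N+1) + C(N−m) = 2 C(N), with C(N−m) read as 0 for N < m, which is also the recurrence of
-- F₀ + ⋯ + F_N.
module Submission where

open import Level using (_⊔_; 0ℓ)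
open import Data.Nat using (ℕ; zero; suc; _+_; _∸_; _^_; _≤_; _<_; _<ᵇ_; _≤ᵇ_; _≤?_; s≤s)
open import Data.Nat.Properties
  using ( ≤-antisym; ≤-trans; ≤-refl; ≤-reflexive; <⇒≤; n≤1+n; ≤⇒≯; <⇒≱; ≰⇒>; m≤m+n; m∸n≤m
        ; <ᵇ-reflects-<; ≤⇒≤ᵇ; suc-injective; +-assoc; +-comm; +-identityʳ; +-cancelʳ-≡; m+n∸m≡n; m+[n∸m]≡n)
  renaming (_≟_ to _≟ℕ_)
open import Data.Nat.Induction using (<-rec)
open import Data.Nat.ListAction using (sum)
open import Data.Nat.ListAction.Properties using (sum-++)
open import Data.Fin using (Fin; zero; suc; toℕ)
open import Data.Fin.Properties using (injective⇒≤)
open import Data.Fin.Subset.Properties using (anySubset?)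
open import Data.Bool using (Bool; true; false; not; _xor_; _∧_; _∨_; if_then_else_; T)
open import Data.Bool.Properties
  using (not-involutive; ¬-not; not-distribˡ-xor; xor-same; if-float; T-≡; T-∧; T-∨) renaming (_≟_ to _≟𝔹_)
import Data.List as List
open import Data.List using (List; []; _∷_; _++_; length; map; filter; take; drop)
open import Data.List.Properties
  using ( length-map; length-++; length-++-≤ˡ; map-id; map-∘; map-cong; take++drop≡id; take-all
        ; ∷-injectiveˡ; ∷-injectiveʳ; ≡-dec)
open import Data.List.Relation.Unary.All as All using (All; []; _∷_)
import Data.List.Relation.Unary.All.Properties as All
import Data.List.Relation.Unary.Any as Any
open import Data.List.Relation.Unary.Any using (here)
open import Data.List.Relation.Unary.Any.Properties using (lookup-index)
open import Data.List.Relation.Unary.AllPairs using ([]; _∷_)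
open import Data.List.Relation.Unary.Unique.Setoid using (Unique)
import Data.List.Relation.Unary.Unique.Setoid.Properties as Unique
open import Data.List.Membership.Propositional.Properties using (∈-lookup)
open import Data.List.Membership.Setoid.Properties
  using (∈-resp-≈; ∉-resp-≈; ∈-map⁺; ∈-map⁻; ∈-++⁺ˡ; ∈-++⁺ʳ; ∈-filter⁺; ∈-filter⁻)
open import Data.Vec using (Vec; []; _∷_; toList; fromList; tabulate; lookup)
open import Data.Vec.Properties
  using (length-toList; toList∘fromList; toList-injective; tabulate∘lookup; tabulate-cong)
open import Data.Vec.Relation.Binary.Equality.Cast using (cast-is-id)
open import Data.Product using (∃; _×_; _,_; proj₁; proj₂)
import Data.Sum as Sum
open import Data.Sum using (_⊎_; inj₁; inj₂)
open import Data.Empty using (⊥)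
open import Function.Bundles using (Equivalence)
open import Function using (_∘_)
open import Induction.WellFounded using (WfRec)
open import Relation.Binary using (Setoid; DecSetoid; Decidable; _Respects_)
open import Relation.Binary.Construct.Closure.ReflexiveTransitive as Star using (Star; ε; _◅_; _◅◅_)
open import Relation.Binary.PropositionalEquality
  using (_≡_; _≢_; refl; sym; trans; cong; cong₂; subst; subst₂; module ≡-Reasoning)
open import Relation.Nullary using (¬_; Dec; yes; no; contradiction)
open import Relation.Nullary.Decidable using (map′; _×-dec_; fromWitness; toWitness)
open import Relation.Nullary.Reflects using (ofʸ; ofⁿ)
open import Relation.Unary using (Pred)

open import Defs

module _ {c ℓ} (S : Setoid c ℓ) where
  open Setoid S using (_≈_) renaming (Carrier to A; sym to ≈-sym; trans to ≈-trans)
  open import Data.List.Membership.Setoid S using (_∈_)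

  record Transversal {p} (D : Pred A p) (R : List A) : Set (c ⊔ ℓ ⊔ p) where
    field
      members : All D R
      unique  : Unique S R
      covers  : ∀ {x} → D x → x ∈ R

  lookup-injective : ∀ {xs} → Unique S xs → ∀ {i j} → List.lookup xs i ≈ List.lookup xs j → i ≡ j
  lookup-injective (_   ∷ _) {zero}  {zero}  _  = refl
  lookup-injective (x≉ ∷ _) {zero}  {suc j} eq = contradiction eq (All.lookup x≉ (∈-lookup j))
  lookup-injective (x≉ ∷ _) {suc i} {zero}  eq = contradiction (≈-sym eq) (All.lookup x≉ (∈-lookup i))
  lookup-injective (_   ∷ u) {suc i} {suc j} eq = cong suc (lookup-injective u eq)

  unique-length-≤ : ∀ {xs ys} → Unique S xs → All (_∈ ys) xs → length xs ≤ length ys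
  unique-length-≤ {xs} {ys} u xs⊆ys = injective⇒≤ index-injective
    where
    index : Fin (length xs) → Fin (length ys)
    index i = Any.index (All.lookup xs⊆ys (∈-lookup i))
    lookup-index≈ : ∀ i → List.lookup xs i ≈ List.lookup ys (index i)
    lookup-index≈ i = lookup-index (All.lookup xs⊆ys (∈-lookup i))
    index-injective : ∀ {i j} → index i ≡ index j → i ≡ j
    index-injective {i} {j} eq = lookup-injective u (≈-trans (lookup-index≈ i)
      (≈-sym (subst (λ k → List.lookup xs j ≈ List.lookup ys k) (sym eq) (lookup-index≈ j))))

  transversal-length : ∀ {p} {D : Pred A p} {R R′} →
                       Transversal D R → Transversal D R′ → length R ≡ length R′
  transversal-length t t′ = ≤-antisym (unique-length-≤ (unique t) (All.map (covers t′) (members t)))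
                                      (unique-length-≤ (unique t′) (All.map (covers t) (members t′)))
    where open Transversal

  transversal-resp : ∀ {p q} {D : Pred A p} {D′ : Pred A q} {R} →
                     (∀ {x} → D x → D′ x) → (∀ {x} → D′ x → D x) → Transversal D R → Transversal D′ R
  transversal-resp D⇒D′ D′⇒D t = record
    { members = All.map D⇒D′ (members t) ; unique = unique t ; covers = covers t ∘ D′⇒D }
    where open Transversal

  empty-transversal : ∀ {p} {D : Pred A p} → (∀ {x} → ¬ D x) → Transversal D []
  empty-transversal ¬D = record { members = [] ; unique = [] ; covers = λ Dx → contradiction Dx ¬D }

module _ {c ℓ} (S : DecSetoid c ℓ) where
  open DecSetoid S using (setoid) renaming (Carrier to A)
  open import Data.List.Membership.DecSetoid S using (_∈_; _∈?_; _∉?_)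

  transversal-++-filter∉ : ∀ {p} {D : Pred A p} {R K} → Transversal setoid D R →
    Unique setoid K → All D K → Transversal setoid D (K ++ filter (_∉? K) R)
  transversal-++-filter∉ {D = D} {R} {K} t uK DK = record
    { members = All.++⁺ DK (All.filter⁺ (_∉? K) members)
    ; unique  = Unique.++⁺ setoid uK (Unique.filter⁺ setoid (_∉? K) unique) disjoint
    ; covers  = covers′
    }
    where
    open Transversal t
    disjoint : ∀ {x} → ¬ (x ∈ K × x ∈ filter (_∉? K) R)
    disjoint (x∈K , x∈rest) = proj₂ (∈-filter⁻ setoid (_∉? K) (∉-resp-≈ setoid) {xs = R} x∈rest) x∈K
    covers′ : ∀ {x} → D x → x ∈ K ++ filter (_∉? K) R
    covers′ {x} Dx with x ∈? K
    ... | yes x∈K = ∈-++⁺ˡ setoid x∈K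
    ... | no  x∉K = ∈-++⁺ʳ setoid K (∈-filter⁺ setoid (_∉? K) (∉-resp-≈ setoid) (covers Dx) x∉K)

if-<ᵇ-yes : ∀ {A : Set} {i j} {x y : A} → i < j → (if i <ᵇ j then x else y) ≡ x
if-<ᵇ-yes {i = i} {j} i<j with i <ᵇ j | <ᵇ-reflects-< i j
... | true  | _        = refl
... | false | ofⁿ i≮j = contradiction i<j i≮j

if-<ᵇ-no : ∀ {A : Set} {i j} {x y : A} → ¬ i < j → (if i <ᵇ j then x else y) ≡ y
if-<ᵇ-no {i = i} {j} i≮j with i <ᵇ j | <ᵇ-reflects-< i j
... | true  | ofʸ i<j = contradiction i<j i≮j
... | false | _        = refl

vec-of-length : ∀ {A : Set} {k} (z : List A) → length z ≡ k → ∃ λ (v : Vec A k) → toList v ≡ z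
vec-of-length z refl = fromList z , toList∘fromList z

toList-injective′ : ∀ {A : Set} {n} {u v : Vec A n} → toList u ≡ toList v → u ≡ v
toList-injective′ {u = u} {v} eq = trans (sym (cast-is-id refl u)) (toList-injective refl u v eq)

if-true : ∀ {A : Set} {b} {x y : A} → b ≡ true → (if b then x else y) ≡ x
if-true refl = refl

≤ᵇ-suc : ∀ x y → (suc x ≤ᵇ suc y) ≡ (x ≤ᵇ y)
≤ᵇ-suc zero    _ = refl
≤ᵇ-suc (suc _) _ = refl

take-++-length : ∀ {A : Set} (w z : List A) → take (length w) (w ++ z) ≡ w
take-++-length []      _ = refl
take-++-length (x ∷ w) z = cong (x ∷_) (take-++-length w z)

drop-++-length : ∀ {A : Set} (w z : List A) → drop (length w) (w ++ z) ≡ z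
drop-++-length []      _ = refl
drop-++-length (_ ∷ w) z = drop-++-length w z

toList-negate-prefix : ∀ k {n} (u : Vec Bool n) →
  toList (tabulate λ i → if toℕ i <ᵇ k then not (lookup u i) else lookup u i)
    ≡ negL (take k (toList u)) ++ drop k (toList u)
toList-negate-prefix zero    u       = cong toList (tabulate∘lookup u)
toList-negate-prefix (suc k) []      = refl
toList-negate-prefix (suc k) (c ∷ u) = cong (not c ∷_) (toList-negate-prefix k u)

m+n≡o⇒n≡o∸m : ∀ {k n o} → k + n ≡ o → n ≡ o ∸ k
m+n≡o⇒n≡o∸m {k} {n} eq = trans (sym (m+n∸m≡n k n)) (cong (_∸ k) eq)

module FibonacciSum (m : ℕ) where

  length-fibList : ∀ N → length (fibList m N) ≡ suc N
  length-fibList zero    = refl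
  length-fibList (suc N) = cong suc (length-fibList N)

  drop-fibList : ∀ {k N} → k ≤ N → drop k (fibList m N) ≡ fibList m (N ∸ k)
  drop-fibList {zero}          _         = refl
  drop-fibList {suc k} {suc N} (s≤s k≤N) = drop-fibList k≤N

  fibSum-pow : ∀ {N} → N < m → fibSum m N ≡ 2 ^ N
  fibSum-pow {zero}  _   = refl
  fibSum-pow {suc N} N<m = begin
    (if suc N <ᵇ m then 2 ^ N else _) + fibSum m N ≡⟨ cong (_+ fibSum m N) (if-<ᵇ-yes N<m) ⟩
    2 ^ N + fibSum m N                            ≡⟨ cong (2 ^ N +_) (fibSum-pow (<⇒≤ N<m)) ⟩
    2 ^ N + 2 ^ N                                 ≡⟨ cong (2 ^ N +_) (sym (+-identityʳ (2 ^ N))) ⟩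
    2 ^ suc N                                     ∎
    where open ≡-Reasoning

  fibSum-double : ∀ {N} → N < m → fibSum m (suc N) ≡ fibSum m N + fibSum m N
  fibSum-double {N} N<m = cong (_+ fibSum m N) next≡
    where
    next≡ : (if suc N <ᵇ m then 2 ^ N else sum (take m (fibList m N))) ≡ fibSum m N
    next≡ with suc N <ᵇ m | <ᵇ-reflects-< (suc N) m
    ... | true  | _ = sym (fibSum-pow N<m)
    ... | false | _ = cong sum (take-all m (fibList m N) (≤-trans (≤-reflexive (length-fibList N)) N<m))

  fibSum-recurrence : ∀ {N} → m ≤ N → fibSum m (suc N) + fibSum m (N ∸ m) ≡ fibSum m N + fibSum m N
  fibSum-recurrence {N} m≤N = begin
    ((if suc N <ᵇ m then 2 ^ N else sum (take m L)) + S) + fibSum m (N ∸ m)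
      ≡⟨ cong₂ (λ x y → (x + S) + sum y) (if-<ᵇ-no (≤⇒≯ (≤-trans m≤N (n≤1+n N)))) (sym (drop-fibList m≤N)) ⟩
    (sum (take m L) + S) + sum (drop m L)  ≡⟨ cong (_+ sum (drop m L)) (+-comm (sum (take m L)) S) ⟩
    (S + sum (take m L)) + sum (drop m L)  ≡⟨ +-assoc S _ _ ⟩
    S + (sum (take m L) + sum (drop m L))  ≡⟨ cong (S +_) (sym (sum-++ (take m L) (drop m L))) ⟩
    S + sum (take m L ++ drop m L)         ≡⟨ cong (λ l → S + sum l) (take++drop≡id m L) ⟩
    S + S                                  ∎
    where
    open ≡-Reasoning
    L : List ℕ
    L = fibList m N
    S : ℕ
    S = fibSum m N

module KeywordRewriting {m : ℕ} (a₁ : Bool) (av : Vec Bool m) where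

  open FibonacciSum m

  a′ : List Bool
  a′ = toList av

  -- suffix c is the tail of whichever of a = a₁ ∷ a′ and ¬a begins with c.
  suffix : Bool → List Bool
  suffix c = map ((c xor a₁) xor_) a′

  key : Bool → List Bool
  key c = c ∷ suffix c

  length-suffix : ∀ c → length (suffix c) ≡ m
  length-suffix c = trans (length-map _ a′) (length-toList av)

  length-key : ∀ c → length (key c) ≡ suc m
  length-key c = cong suc (length-suffix c)

  negL-key : ∀ c → negL (key c) ≡ key (not c)
  negL-key c = cong (not c ∷_) (trans (sym (map-∘ a′)) (map-cong not-xor a′))
    where
    not-xor : ∀ x → not ((c xor a₁) xor x) ≡ (not c xor a₁) xor x
    not-xor x = trans (not-distribˡ-xor (c xor a₁) x) (cong (_xor x) (not-distribˡ-xor c a₁))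

  data Step : List Bool → List Bool → Set where
    flip  : ∀ c z → Step (key c ++ z) (key (not c) ++ z)
    there : ∀ {c x y} → Step x y → Step (c ∷ x) (c ∷ y)

  infix 4 _≈_
  _≈_ : List Bool → List Bool → Set
  _≈_ = Star Step

  length-suffix-++ : ∀ c z → length (suffix c ++ z) ≡ m + length z
  length-suffix-++ c z = trans (length-++ (suffix c)) (cong (_+ length z) (length-suffix c))

  step-sym : ∀ {x y} → Step x y → Step y x
  step-sym (flip c z) =
    subst (λ d → Step (key (not c) ++ z) (key d ++ z)) (not-involutive c) (flip (not c) z)
  step-sym (there s)  = there (step-sym s)

  ≈-sym : ∀ {x y} → x ≈ y → y ≈ x
  ≈-sym = Star.reverse step-sym

  step-length : ∀ {x y} → Step x y → length x ≡ length y
  step-length (flip c z) = cong suc (trans (length-suffix-++ c z) (sym (length-suffix-++ (not c) z)))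
  step-length (there s)  = cong suc (step-length s)

  ≈-length : ∀ {x y} → x ≈ y → length x ≡ length y
  ≈-length ε        = refl
  ≈-length (s ◅ ss) = trans (step-length s) (≈-length ss)

  ∷⁺ : ∀ c {x y} → x ≈ y → c ∷ x ≈ c ∷ y
  ∷⁺ c = Star.gmap (c ∷_) there

  ++⁺ˡ : ∀ p {x y} → x ≈ y → p ++ x ≈ p ++ y
  ++⁺ˡ []      eq = eq
  ++⁺ˡ (c ∷ p) eq = ∷⁺ c (++⁺ˡ p eq)

  Cancellable : ℕ → Set
  Cancellable N = ∀ c {y y′} → length y ≡ N → c ∷ y ≈ c ∷ y′ → y ≈ y′

  cancel-prefix : ∀ {N} → WfRec _<_ Cancellable N →
                  ∀ p {z w} → length (p ++ z) ≤ N → p ++ z ≈ p ++ w → z ≈ w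
  cancel-prefix ih []      _   eq = eq
  cancel-prefix ih (c ∷ p) len eq = cancel-prefix ih p (<⇒≤ len) (ih len c refl eq)

  data ClassOf (c : Bool) (y₀ : List Bool) : List Bool → Set where
    same    : ∀ {y} → y₀ ≈ y → ClassOf c y₀ (c ∷ y)
    crossed : ∀ {y} z → y₀ ≈ suffix c ++ z → suffix (not c) ++ z ≈ y → ClassOf c y₀ (not c ∷ y)

  classOf-step : ∀ {c y₀ x x′} → WfRec _<_ Cancellable (length y₀) →
                 ClassOf c y₀ x → Step x x′ → ClassOf c y₀ x′
  classOf-step ih (same p)        (flip _ z) = crossed z p ε
  classOf-step ih (same p)        (there s)  = same (p ◅◅ s ◅ ε)
  classOf-step ih (crossed z p q) (there s)  = crossed z p (q ◅◅ s ◅ ε)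
  -- The head flips back to c; cancelling suffix (not c) in words shorter than c ∷ y₀ gives z ≈ z′.
  classOf-step {c} {y₀} ih (crossed z p q) (flip _ z′) rewrite not-involutive c =
    same (p ◅◅ ++⁺ˡ (suffix c) (cancel-prefix ih (suffix (not c)) (≤-reflexive len) q))
    where
    len : length (suffix (not c) ++ z) ≡ length y₀
    len = trans (length-suffix-++ (not c) z) (trans (sym (length-suffix-++ c z)) (sym (≈-length p)))

  classOf-≈ : ∀ {c y₀ x x′} → WfRec _<_ Cancellable (length y₀) →
              ClassOf c y₀ x → x ≈ x′ → ClassOf c y₀ x′
  classOf-≈ ih cl ε        = cl
  classOf-≈ ih cl (s ◅ ss) = classOf-≈ ih (classOf-step ih cl s) ss

  same⁻¹ : ∀ c {y₀ y} → ClassOf c y₀ (c ∷ y) → y₀ ≈ y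
  same⁻¹ true  (same p) = p
  same⁻¹ false (same p) = p

  cancellable : ∀ N → Cancellable N
  cancellable = <-rec Cancellable step
    where
    step : ∀ N → WfRec _<_ Cancellable N → Cancellable N
    step _ ih c refl eq = same⁻¹ c (classOf-≈ ih (same ε) eq)

  ∷-cancel : ∀ c {y y′} → c ∷ y ≈ c ∷ y′ → y ≈ y′
  ∷-cancel c = cancellable _ c refl

  ++-cancelˡ : ∀ p {z w} → p ++ z ≈ p ++ w → z ≈ w
  ++-cancelˡ p = cancel-prefix (λ _ → cancellable _) p ≤-refl

  Crossing : Bool → List Bool → List Bool → Set
  Crossing c x y = ∃ λ z → x ≈ suffix c ++ z × y ≈ suffix (not c) ++ z

  crossed⁻¹ : ∀ c {y₀ y} → ClassOf c y₀ (not c ∷ y) → Crossing c y₀ y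
  crossed⁻¹ true  (crossed z p q) = z , p , ≈-sym q
  crossed⁻¹ false (crossed z p q) = z , p , ≈-sym q

  ∷-cross⁻ : ∀ c {x y} → c ∷ x ≈ not c ∷ y → Crossing c x y
  ∷-cross⁻ c eq = crossed⁻¹ c (classOf-≈ (λ _ → cancellable _) (same ε) eq)

  ∷-cross⁺ : ∀ c {x y} → Crossing c x y → c ∷ x ≈ not c ∷ y
  ∷-cross⁺ c (z , p , q) = ∷⁺ c p ◅◅ flip c z ◅ ∷⁺ (not c) (≈-sym q)

  ≈-suffix-length : ∀ c {x z} → x ≈ suffix c ++ z → length x ≡ m + length z
  ≈-suffix-length c {z = z} p = trans (≈-length p) (length-suffix-++ c z)

  -- anySubset? decides existentials over Subset k, which is Vec Bool k.
  crossing? : ∀ c {N x y} → (∀ {u v} → length u ≡ N → length v ≡ N → Dec (u ≈ v)) →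
              length x ≡ N → length y ≡ N → Dec (Crossing c x y)
  crossing? c {N} {x} {y} _≟ₙ_ lx ly with m ≤? N
  ... | no m≰N = no λ (z , p , _) →
    m≰N (subst (m ≤_) (trans (sym (≈-suffix-length c p)) lx) (m≤m+n m (length z)))
  ... | yes m≤N = map′ (λ (v , p , q) → toList v , p , q) fromCrossing
    (anySubset? λ v → (lx ≟ₙ length-suffix-++-toList c v) ×-dec (ly ≟ₙ length-suffix-++-toList (not c) v))
    where
    length-suffix-++-toList : ∀ d (v : Vec Bool (N ∸ m)) → length (suffix d ++ toList v) ≡ N
    length-suffix-++-toList d v =
      trans (length-suffix-++ d (toList v)) (trans (cong (m +_) (length-toList v)) (m+[n∸m]≡n m≤N))
    fromCrossing : Crossing c x y →
                   ∃ λ (v : Vec Bool (N ∸ m)) → x ≈ suffix c ++ toList v × y ≈ suffix (not c) ++ toList v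
    fromCrossing (z , p , q) with vec-of-length z (m+n≡o⇒n≡o∸m (trans (sym (≈-suffix-length c p)) lx))
    ... | v , refl = v , p , q

  ≈-dec : ∀ N {x y} → length x ≡ N → length y ≡ N → Dec (x ≈ y)
  ≈-dec zero    {[]}    {[]}     _  _  = yes ε
  ≈-dec (suc N) {c ∷ x} {c′ ∷ y} lx ly with c ≟𝔹 c′
  ... | yes refl = map′ (∷⁺ c) (∷-cancel c) (≈-dec N (suc-injective lx) (suc-injective ly))
  ... | no c≢c′ rewrite ¬-not (c≢c′ ∘ sym) =
    map′ (∷-cross⁺ c) (∷-cross⁻ c) (crossing? c (≈-dec N) (suc-injective lx) (suc-injective ly))
  ≈-dec zero    {_ ∷ _}          ()  _
  ≈-dec zero    {[]}    {_ ∷ _}  _   ()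
  ≈-dec (suc N) {[]}             ()  _
  ≈-dec (suc N) {_ ∷ _} {[]}     _   ()

  _≈?_ : Decidable _≈_
  x ≈? y with length x ≟ℕ length y
  ... | yes eq = ≈-dec _ refl (sym eq)
  ... | no  neq = no (neq ∘ ≈-length)

  ≈-decSetoid : DecSetoid 0ℓ 0ℓ
  ≈-decSetoid = record
    { Carrier          = List Bool
    ; _≈_              = _≈_
    ; isDecEquivalence = record
      { isEquivalence = record { refl = ε ; sym = ≈-sym ; trans = _◅◅_ }
      ; _≟_           = _≈?_
      }
    }

  open DecSetoid ≈-decSetoid using (setoid)
  open import Data.List.Membership.DecSetoid ≈-decSetoid using (_∈_; _∈?_; _∉?_)
  open Transversal

  Len : ℕ → Pred (List Bool) 0ℓ
  Len N x = length x ≡ N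

  Len-resp : ∀ {N} → Len N Respects _≈_
  Len-resp eq lx = trans (sym (≈-length eq)) lx

  module Extension (c : Bool) {N R Q} (tR : Transversal setoid (Len N) R)
                   (tQ : Transversal setoid (Len N ∘ (suffix c ++_)) Q) where

    Crossable : List (List Bool)
    Crossable = map (suffix c ++_) Q

    Rest : List (List Bool)
    Rest = filter (_∉? Crossable) R

    R′ : List (List Bool)
    R′ = map (not c ∷_) R ++ map (c ∷_) Rest

    R-split : Transversal setoid (Len N) (Crossable ++ Rest)
    R-split = transversal-++-filter∉ ≈-decSetoid tR
      (Unique.map⁺ setoid setoid (++-cancelˡ (suffix c)) (unique tQ)) (All.map⁺ (members tQ))

    rest-not-crossing : ∀ {r r′} → r′ ∈ Rest → ¬ Crossing c r′ r
    rest-not-crossing r′∈Rest (z , r′≈ , _)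
      with ∈-filter⁻ setoid (_∉? Crossable) (∉-resp-≈ setoid) {xs = R} r′∈Rest
    ... | r′∈R , r′∉Crossable = r′∉Crossable (∈-resp-≈ setoid (≈-sym r′≈) suffix-z∈Crossable)
      where
      z∈Q : z ∈ Q
      z∈Q = covers tQ (Len-resp r′≈ (All.lookupₛ setoid Len-resp (members tR) r′∈R))
      suffix-z∈Crossable : suffix c ++ z ∈ Crossable
      suffix-z∈Crossable = ∈-map⁺ setoid setoid (++⁺ˡ (suffix c)) z∈Q

    disjoint : ∀ {x} → ¬ (x ∈ map (not c ∷_) R × x ∈ map (c ∷_) Rest)
    disjoint (x∈₁ , x∈₂) with ∈-map⁻ setoid setoid x∈₁ | ∈-map⁻ setoid setoid x∈₂
    ... | r , _ , x≈¬c∷r | r′ , r′∈Rest , x≈c∷r′ =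
      rest-not-crossing r′∈Rest (∷-cross⁻ c (≈-sym x≈c∷r′ ◅◅ x≈¬c∷r))

    covers-R′ : ∀ {x} → Len (suc N) x → x ∈ R′
    covers-R′ {e ∷ y} ly with e ≟𝔹 c
    ... | no e≢c rewrite ¬-not e≢c =
      ∈-++⁺ˡ setoid (∈-map⁺ setoid setoid (∷⁺ (not c)) (covers tR (suc-injective ly)))
    ... | yes refl with y ∈? Crossable
    ...   | no y∉Crossable =
      ∈-++⁺ʳ setoid _ (∈-map⁺ setoid setoid (∷⁺ c)
        (∈-filter⁺ setoid (_∉? Crossable) (∉-resp-≈ setoid) (covers tR (suc-injective ly)) y∉Crossable))
    ...   | yes y∈Crossable with ∈-map⁻ setoid setoid y∈Crossable
    ...     | q , _ , y≈ = ∈-resp-≈ setoid (≈-sym (∷-cross⁺ c (q , y≈ , ε)))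
                             (∈-++⁺ˡ setoid (∈-map⁺ setoid setoid (∷⁺ (not c)) (covers tR lq)))
      where
      lq : length (suffix (not c) ++ q) ≡ N
      lq = trans (length-suffix-++ (not c) q) (trans (sym (≈-suffix-length c y≈)) (suc-injective ly))

    R′-transversal : Transversal setoid (Len (suc N)) R′
    R′-transversal = record
      { members = All.++⁺ (All.map⁺ (All.map (cong suc) (members tR)))
                          (All.map⁺ (All.map (cong suc) (All.filter⁺ (_∉? Crossable) (members tR))))
      ; unique  = Unique.++⁺ setoid
                    (Unique.map⁺ setoid setoid (∷-cancel (not c)) (unique tR))
                    (Unique.map⁺ setoid setoid (∷-cancel c) (Unique.filter⁺ setoid (_∉? Crossable) (unique tR)))
                    disjoint
      ; covers  = covers-R′
      }

    length-R′ : length R′ + length Q ≡ length R + length R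
    length-R′ = begin
      length R′ + length Q                  ≡⟨ cong (_+ length Q) (trans (length-++ (map (not c ∷_) R))
                                                 (cong₂ _+_ (length-map _ R) (length-map _ Rest))) ⟩
      (length R + length Rest) + length Q   ≡⟨ +-assoc (length R) _ _ ⟩
      length R + (length Rest + length Q)   ≡⟨ cong (length R +_) (+-comm (length Rest) (length Q)) ⟩
      length R + (length Q + length Rest)   ≡⟨ cong (length R +_) (sym length-R) ⟩
      length R + length R                   ∎
      where
      open ≡-Reasoning
      length-R : length R ≡ length Q + length Rest
      length-R = trans (transversal-length setoid tR R-split)
                       (trans (length-++ Crossable) (cong (_+ length Rest) (length-map _ Q)))

  transversal-suc : ∀ c {N R Q} →
                    Transversal setoid (Len N) R → Transversal setoid (Len N ∘ (suffix c ++_)) Q →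
                    ∃ λ R′ → Transversal setoid (Len (suc N)) R′ × length R′ + length Q ≡ length R + length R
  transversal-suc c tR tQ = _ , R′-transversal , length-R′
    where open Extension c tR tQ

  FibTransversal : ℕ → Set
  FibTransversal N = ∃ λ R → Transversal setoid (Len N) R × length R ≡ fibSum m N

  fibTransversal-zero : FibTransversal 0
  fibTransversal-zero =
    ([] ∷ []) , record { members = refl ∷ [] ; unique = [] ∷ [] ; covers = λ { {[]} _ → here ε } } , refl

  fibTransversal-suc-< : ∀ {N} → N < m → FibTransversal N → FibTransversal (suc N)
  fibTransversal-suc-< {N} N<m (R , tR , |R|)
    with transversal-suc true tR (empty-transversal setoid no-crossing)
    where
    no-crossing : ∀ {z} → ¬ Len N (suffix true ++ z)
    no-crossing {z} l =
      <⇒≱ N<m (subst (m ≤_) (trans (sym (length-suffix-++ true z)) l) (m≤m+n m (length z)))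
  ... | R′ , tR′ , count = R′ , tR′ , (begin
    length R′                 ≡⟨ sym (+-identityʳ _) ⟩
    length R′ + 0             ≡⟨ count ⟩
    length R + length R       ≡⟨ cong₂ _+_ |R| |R| ⟩
    fibSum m N + fibSum m N   ≡⟨ sym (fibSum-double N<m) ⟩
    fibSum m (suc N)          ∎)
    where open ≡-Reasoning

  fibTransversal-suc-≥ : ∀ {N} → m ≤ N → FibTransversal N → FibTransversal (N ∸ m) → FibTransversal (suc N)
  fibTransversal-suc-≥ {N} m≤N (R , tR , |R|) (Q , tQ , |Q|)
    with transversal-suc true tR (transversal-resp setoid to from tQ)
    where
    to : ∀ {z} → Len (N ∸ m) z → Len N (suffix true ++ z)
    to {z} l = trans (length-suffix-++ true z) (trans (cong (m +_) l) (m+[n∸m]≡n m≤N))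
    from : ∀ {z} → Len N (suffix true ++ z) → Len (N ∸ m) z
    from {z} l = m+n≡o⇒n≡o∸m (trans (sym (length-suffix-++ true z)) l)
  ... | R′ , tR′ , count = R′ , tR′ , +-cancelʳ-≡ (length Q) _ _ (begin
    length R′ + length Q                    ≡⟨ count ⟩
    length R + length R                     ≡⟨ cong₂ _+_ |R| |R| ⟩
    fibSum m N + fibSum m N                 ≡⟨ sym (fibSum-recurrence m≤N) ⟩
    fibSum m (suc N) + fibSum m (N ∸ m)     ≡⟨ cong (fibSum m (suc N) +_) (sym |Q|) ⟩
    fibSum m (suc N) + length Q             ∎)
    where open ≡-Reasoning

  fibTransversal : ∀ N → FibTransversal N
  fibTransversal = <-rec FibTransversal step
    where
    step : ∀ N → WfRec _<_ FibTransversal N → FibTransversal N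
    step zero    _  = fibTransversal-zero
    step (suc N) ih with m ≤? N
    ... | yes m≤N = fibTransversal-suc-≥ m≤N (ih ≤-refl) (ih (s≤s (m∸n≤m N m)))
    ... | no  m≰N = fibTransversal-suc-< (≰⇒> m≰N) (ih ≤-refl)

module SimpleMaps {m : ℕ} (a₁ : Bool) (av : Vec Bool m) where

  open KeywordRewriting a₁ av

  a : Vec Bool (suc m)
  a = a₁ ∷ av

  isKey : List Bool → Bool
  isKey w = eqL w (toList a) ∨ eqL w (negL (toList a))

  key-a₁ : key a₁ ≡ toList a
  key-a₁ = cong (a₁ ∷_) (trans (cong (λ b → map (b xor_) a′) (xor-same a₁)) (map-id a′))

  key-not-a₁ : key (not a₁) ≡ negL (toList a)
  key-not-a₁ = trans (sym (negL-key a₁)) (cong negL key-a₁)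

  eqL-complete : ∀ {w v} → w ≡ v → T (eqL w v)
  eqL-complete {w} {v} = fromWitness {a? = ≡-dec _≟𝔹_ w v}

  eqL-sound : ∀ {w v} → T (eqL w v) → w ≡ v
  eqL-sound {w} {v} = toWitness {a? = ≡-dec _≟𝔹_ w v}

  key-cases : ∀ c → key c ≡ toList a ⊎ key c ≡ negL (toList a)
  key-cases c with c ≟𝔹 a₁
  ... | yes refl = inj₁ key-a₁
  ... | no  c≢a₁ rewrite ¬-not c≢a₁ = inj₂ key-not-a₁

  isKey-key : ∀ c → T (isKey (key c))
  isKey-key c =
    Equivalence.from (T-∨ {eqL (key c) (toList a)}) (Sum.map eqL-complete eqL-complete (key-cases c))

  key-of-isKey : ∀ w → T (isKey w) → ∃ λ c → w ≡ key c
  key-of-isKey w t with Equivalence.to (T-∨ {eqL w (toList a)}) t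
  ... | inj₁ w≡a  = a₁ , trans (eqL-sound w≡a) (sym key-a₁)
  ... | inj₂ w≡¬a = not a₁ , trans (eqL-sound w≡¬a) (sym key-not-a₁)

  negatePrefix : List Bool → List Bool
  negatePrefix l =
    if (suc m ≤ᵇ length l) ∧ isKey (take (suc m) l) then negL (take (suc m) l) ++ drop (suc m) l else l

  toList-φ-zero : ∀ {n} (u : Word (suc n)) → toList (φ a zero u) ≡ negatePrefix (toList u)
  toList-φ-zero {n} u = begin
    toList (if C then V else u)
      ≡⟨ if-float toList C ⟩
    (if C then toList V else toList u)
      ≡⟨ cong (λ l → if C then l else toList u) (toList-negate-prefix (suc m) u) ⟩
    (if C then negL w ++ z else toList u)
      ≡⟨ cong (λ k → if (suc m ≤ᵇ k) ∧ isKey w then negL w ++ z else toList u) (sym (length-toList u)) ⟩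
    negatePrefix (toList u)
      ∎
    where
    open ≡-Reasoning
    w z : List Bool
    w = take (suc m) (toList u)
    z = drop (suc m) (toList u)
    C : Bool
    C = (suc m ≤ᵇ suc n) ∧ isKey w
    V : Word (suc n)
    V = tabulate λ i → if toℕ i <ᵇ suc m then not (lookup u i) else lookup u i

  φ-suc : ∀ {n} (j : Fin n) c (u : Word n) → φ a (suc j) (c ∷ u) ≡ c ∷ φ a j u
  φ-suc {n} j c u = begin
    (if (suc X ≤ᵇ suc n) ∧ isKey w then c ∷ tabulate (f ∘ suc) else c ∷ u)
      ≡⟨ cong₂ (λ b t → if b ∧ isKey w then c ∷ t else c ∷ u) (≤ᵇ-suc X n)
               (tabulate-cong λ i → cong (λ b → if b ∧ (toℕ i <ᵇ X) then not (lookup u i) else lookup u i)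
                                           (≤ᵇ-suc (toℕ j) (toℕ i))) ⟩
    (if (X ≤ᵇ n) ∧ isKey w then c ∷ tabulate g else c ∷ u)
      ≡⟨ sym (if-float (c ∷_) ((X ≤ᵇ n) ∧ isKey w)) ⟩
    c ∷ φ a j u ∎
    where
    open ≡-Reasoning
    X : ℕ
    X = toℕ j + suc m
    w : List Bool
    w = take (suc m) (drop (toℕ j) (toList u))
    f : Fin (suc n) → Bool
    f i = if (toℕ (suc j) ≤ᵇ toℕ i) ∧ (toℕ i <ᵇ suc X) then not (lookup (c ∷ u) i) else lookup (c ∷ u) i
    g : Fin n → Bool
    g i = if (toℕ j ≤ᵇ toℕ i) ∧ (toℕ i <ᵇ X) then not (lookup u i) else lookup u i

  negatePrefix-step : ∀ l → negatePrefix l ≡ l ⊎ Step l (negatePrefix l)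
  negatePrefix-step l with (suc m ≤ᵇ length l) ∧ isKey (take (suc m) l) in cond
  ... | false = inj₁ refl
  ... | true with key-of-isKey (take (suc m) l) (proj₂ (Equivalence.to T-∧ (Equivalence.from T-≡ cond)))
  ...   | c , w≡key = inj₂ (subst₂ Step (trans (cong (_++ z) (sym w≡key)) (take++drop≡id (suc m) l))
                                       (cong (λ w → negL w ++ z) (sym w≡key))
                                       flip-key)
    where
    z : List Bool
    z = drop (suc m) l
    flip-key : Step (key c ++ z) (negL (key c) ++ z)
    flip-key = subst (λ y → Step (key c ++ z) (y ++ z)) (sym (negL-key c)) (flip c z)

  negatePrefix-key : ∀ c z → negatePrefix (key c ++ z) ≡ key (not c) ++ z
  negatePrefix-key c z = begin
    negatePrefix (key c ++ z)
      ≡⟨ if-true cond ⟩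
    negL (take (suc m) (key c ++ z)) ++ drop (suc m) (key c ++ z)
      ≡⟨ cong₂ (λ w y → negL w ++ y) take-key drop-key ⟩
    negL (key c) ++ z
      ≡⟨ cong (_++ z) (negL-key c) ⟩
    key (not c) ++ z
      ∎
    where
    open ≡-Reasoning
    take-key : take (suc m) (key c ++ z) ≡ key c
    take-key = subst (λ k → take k (key c ++ z) ≡ key c) (length-key c) (take-++-length (key c) z)
    drop-key : drop (suc m) (key c ++ z) ≡ z
    drop-key = subst (λ k → drop k (key c ++ z) ≡ z) (length-key c) (drop-++-length (key c) z)
    long-enough : suc m ≤ length (key c ++ z)
    long-enough = subst (_≤ length (key c ++ z)) (length-key c) (length-++-≤ˡ (key c))
    cond : (suc m ≤ᵇ length (key c ++ z)) ∧ isKey (take (suc m) (key c ++ z)) ≡ true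
    cond = Equivalence.to T-≡ (Equivalence.from T-∧
             (≤⇒≤ᵇ long-enough , subst (T ∘ isKey) (sym take-key) (isKey-key c)))

  φ-step : ∀ {n} (j : Fin n) (u : Word n) → φ a j u ≡ u ⊎ Step (toList u) (toList (φ a j u))
  φ-step zero u with negatePrefix-step (toList u)
  ... | inj₁ eq = inj₁ (toList-injective′ (trans (toList-φ-zero u) eq))
  ... | inj₂ s  = inj₂ (subst (Step (toList u)) (sym (toList-φ-zero u)) s)
  φ-step (suc j) (c ∷ u) rewrite φ-suc j c u with φ-step j u
  ... | inj₁ eq = inj₁ (cong (c ∷_) eq)
  ... | inj₂ s  = inj₂ (there s)

  step-φ : ∀ {n} (u : Word n) {x l} → x ≡ toList u → Step x l → ∃ λ j → toList (φ a j u) ≡ l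
  step-φ (c ∷ u) eq (flip c′ z) =
    zero , trans (toList-φ-zero (c ∷ u)) (trans (cong negatePrefix (sym eq)) (negatePrefix-key c′ z))
  step-φ (c ∷ u) eq (there s) with step-φ u (∷-injectiveʳ eq) s
  ... | j , e = suc j , trans (cong toList (φ-suc j c u)) (cong₂ _∷_ (sym (∷-injectiveˡ eq)) e)
  step-φ [] () (flip _ _)
  step-φ [] () (there _)

  ∼⇒≈ : ∀ {n} js {u v : Word n} → applySeq a js u ≡ v → toList u ≈ toList v
  ∼⇒≈ []       refl = ε
  ∼⇒≈ (j ∷ js) {u} eq with φ-step j u
  ... | inj₁ φu≡u = ∼⇒≈ js (subst (λ w → applySeq a js w ≡ _) φu≡u eq)
  ... | inj₂ s    = s ◅ ∼⇒≈ js eq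

  ≈⇒∼ : ∀ {n} {u v : Word n} {x} → x ≡ toList u → x ≈ toList v → u ∼⟨ a ⟩ v
  ≈⇒∼ eq ε = [] , toList-injective′ (sym eq)
  ≈⇒∼ {u = u} eq (s ◅ ss) with step-φ u eq s
  ... | j , e with ≈⇒∼ (sym e) ss
  ...   | js , e′ = j ∷ js , e′

  open DecSetoid ≈-decSetoid using (setoid)
  open import Data.List.Membership.Setoid setoid using (_∈_)

  numClasses : ∀ {n R} → Transversal setoid (Len n) R → NumClasses n a (length R)
  numClasses {n} {R} t = r , distinct , complete
    where
    open Transversal t
    word : ∀ p → ∃ λ (v : Word n) → toList v ≡ List.lookup R p
    word p = vec-of-length (List.lookup R p) (All.lookup members (∈-lookup p))
    r : Fin (length R) → Word n
    r = proj₁ ∘ word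
    distinct : ∀ p q → p ≢ q → r p ∼⟨ a ⟩ r q → ⊥
    distinct p q p≢q (js , e) =
      p≢q (lookup-injective setoid unique (subst₂ _≈_ (proj₂ (word p)) (proj₂ (word q)) (∼⇒≈ js e)))
    complete : ∀ u → ∃ λ p → u ∼⟨ a ⟩ r p
    complete u = Any.index u∈R , ≈⇒∼ refl (subst (toList u ≈_) (sym (proj₂ (word _))) (lookup-index u∈R))
      where
      u∈R : toList u ∈ R
      u∈R = covers (length-toList u)

theorem1p1 : (n m : ℕ) → 1 ≤ n → 1 ≤ m → (a : Vec Bool (suc m)) →
    NumClasses n a (fibSum m n)
-- The count is also correct for n = 0 and m = 0.
theorem1p1 n m _ _ (a₁ ∷ av) with KeywordRewriting.fibTransversal a₁ av n
... | R , tR , |R| = subst (NumClasses n (a₁ ∷ av)) |R| (SimpleMaps.numClasses a₁ av tR)
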